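{- For all $i,j\in\mathbb{Z}$ and all $k\ge -1$, $$\frac{m_{i,j-1,k}\,m_{i,j+1,k}}{m_{i-1,j,k}\,m_{i+1,j,k}}=M_{3i+j,k},\qquad\text{where } M_{l,k}=\prod_{i'=-k}^{k}y_{l+3i'}.$$
   Context: Let $y_j$ ($j\in\mathbb{Z}$) be indeterminates (with indices read modulo $2n$ for a fixed $n\ge1$). Product convention: $\prod_{i=a}^{a-1}z_i=1$ and $\prod_{i=a}^{b}z_i=\prod_{i=b+1}^{a-1}z_i^{ -1}$ for $b<a-1$ (so $M_{l,-1}=y_l^{ -1}$). Define Laurent monomials $m_{i,j,0}=\prod_{l=0}^{j-1}\prod_{m=0}^{l}y_{3i+j-4l+6m-1}$ (with the convention this gives $m_{i,-1,0}=m_{i,0,0}=1$ and $m_{i,j,0}=\prod_{l=j}^{ -2}\prod_{m=l+1}^{ -1}y_{3i+j-4l+6m-1}$ for $j\le-2$), $m_{i,j,-1}=1/m_{i,j,0}$, and $m_{i,j,k}=m_{i-1,j,k-1}m_{i+1,j,k-1}/m_{i,j,k-2}$ for $k\ge1$. -}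

module Defs where

open import Data.Nat as ℕ using (ℕ; zero; suc)
open import Data.Nat.Divisibility using (_∣?_)
open import Data.Integer using (ℤ; +_; -[1+_]; _+_; _-_; _*_; -_; ∣_∣)
open import Relation.Nullary.Decidable using (does)
open import Data.Bool using (if_then_else_)

-- A Laurent monomial in the indeterminates y_j (j ∈ ℤ, indices read mod 2n)
-- is represented by its exponent vector: r ↦ exponent of y_r.  Such vectors
-- are 2n-periodic; equality of monomials is pointwise equality.
Mono : Set
Mono = ℤ → ℤ

one : Mono
one _ = + 0

infixl 7 _·_ _÷_
_·_ : Mono → Mono → Mono
(f · g) r = f r + g r

inv : Mono → Mono
inv f r = - f r

_÷_ : Mono → Mono → Mono
f ÷ g = f · inv g

y : ℕ → ℤ → Mono
y n l r = if does ((2 ℕ.* n) ∣? ∣ l - r ∣) then + 1 else + 0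

prodFrom : ℤ → ℕ → (ℤ → Mono) → Mono
prodFrom a zero    f = one
prodFrom a (suc c) f = f a · prodFrom (a + + 1) c f

-- ∏_{i=a}^{b} f i with the convention: empty product = 1 when b = a-1,
-- and ∏_{i=a}^{b} = ∏_{i=b+1}^{a-1} (f i)⁻¹ when b < a-1.
prodR : ℤ → ℤ → (ℤ → Mono) → Mono
prodR a b f with b + + 1 - a
... | + c      = prodFrom a c f
... | -[1+ c ] = inv (prodFrom (b + + 1) (suc c) f)

m0 : ℕ → ℤ → ℤ → Mono
m0 n i j = prodR (+ 0) (j - + 1) λ l → prodR (+ 0) l λ m →
  y n (+ 3 * i + j - + 4 * l + + 6 * m - + 1)

-- mAux n i j t = m_{i,j,t-1}
mAux : ℕ → ℤ → ℤ → ℕ → Mono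
mAux n i j zero          = inv (m0 n i j)
mAux n i j (suc zero)    = m0 n i j
mAux n i j (suc (suc t)) =
  mAux n (i - + 1) j (suc t) · mAux n (i + + 1) j (suc t) ÷ mAux n i j t

-- m_{i,j,k} for k ≥ -1 (value for k < -1 is irrelevant)
m : ℕ → ℤ → ℤ → ℤ → Mono
m n i j k = mAux n i j ∣ k + + 1 ∣

M : ℕ → ℤ → ℤ → Mono
M n l k = prodR (- k) k λ i' → y n (l + + 3 * i')

-- Everything is a statement about exponent vectors, so products become sums and the
-- identity is linear; nothing about the indeterminates y_l is used beyond their
-- indexing.  For k = 0, m_{i,j,0} depends on i only through l = 3i + j, and raising j
-- by one adds to each of the four double products a single row of y's; these rows
-- cancel except for one term, so the ratio is independent of j and equals y_l.
-- For k ≥ 1 the ratio obeys the same recurrence in (i, k) as the m's themselves,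
-- while M satisfies the discrete wave equation
-- M_{l-3,K} M_{l+3,K} = M_{l,K+1} M_{l,K-1}, which is that recurrence read at l = 3i + j.

module Submission where

open import Defs
open import Data.Nat as ℕ using (ℕ; zero; suc; _≥_)
open import Data.Integer
  using (ℤ; +_; -[1+_]; _+_; _-_; _*_; -_; _≤_; -≤-; ∣_∣; pred) renaming (suc to sucℤ)
open import Data.Integer.Properties using (+-identityʳ; +-assoc; +-comm; i-j≡0⇒i≡j)
import Data.Nat.Properties as ℕ
open import Data.Integer.Tactic.RingSolver using (solve-∀)
open import Relation.Binary.PropositionalEquality
open ≡-Reasoning

-- prodR with the length b + 1 - a of its range exposed as an argument, so that the
-- lengths of neighbouring ranges can be related.
signedProd : ℤ → ℤ → ℤ → (ℤ → Mono) → Mono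
signedProd (+ c)    a b f = prodFrom a c f
signedProd -[1+ c ] a b f = inv (prodFrom (b + + 1) (suc c) f)

prodR≡signedProd : ∀ a b f → prodR a b f ≡ signedProd (b + + 1 - a) a b f
prodR≡signedProd a b f with b + + 1 - a
... | + c      = refl
... | -[1+ c ] = refl

prodFrom-cong : ∀ a c {f g : ℤ → Mono} → (∀ t → f t ≗ g t) → prodFrom a c f ≗ prodFrom a c g
prodFrom-cong a zero    f≗g r = refl
prodFrom-cong a (suc c) f≗g r = cong₂ _+_ (f≗g a r) (prodFrom-cong (a + + 1) c f≗g r)

prodR-cong : ∀ a b {f g : ℤ → Mono} → (∀ t → f t ≗ g t) → prodR a b f ≗ prodR a b g
prodR-cong a b f≗g r with b + + 1 - a
... | + c      = prodFrom-cong a c f≗g r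
... | -[1+ c ] = cong -_ (prodFrom-cong (b + + 1) (suc c) f≗g r)

prodFrom-snoc : ∀ a c f → prodFrom a (suc c) f ≗ prodFrom a c f · f (a + + c)
prodFrom-snoc a zero    f r rewrite +-identityʳ a = +-comm (f a r) (+ 0)
prodFrom-snoc a (suc c) f r = begin
  f a r + prodFrom (a + + 1) (suc c) f r
    ≡⟨ cong (λ x → f a r + x) (prodFrom-snoc (a + + 1) c f r) ⟩
  f a r + (prodFrom (a + + 1) c f r + f (a + + 1 + + c) r)
    ≡⟨ cong (λ x → f a r + (prodFrom (a + + 1) c f r + f x r)) (+-assoc a (+ 1) (+ c)) ⟩
  f a r + (prodFrom (a + + 1) c f r + f (a + + suc c) r)
    ≡⟨ +-assoc (f a r) _ _ ⟨
  f a r + prodFrom (a + + 1) c f r + f (a + + suc c) r ∎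

private
  a+[b+1-a]≡b+1 : ∀ a b → a + (b + + 1 - a) ≡ b + + 1
  a+[b+1-a]≡b+1 = solve-∀
  b+1-[b+1-a]≡a : ∀ a b → b + + 1 - (b + + 1 - a) ≡ a
  b+1-[b+1-a]≡a = solve-∀
  length-suc : ∀ a b → b + + 1 + + 1 - a ≡ + 1 + (b + + 1 - a)
  length-suc = solve-∀
  length-pred : ∀ a b → b + + 1 - (a + + 1) ≡ -[1+ 0 ] + (b + + 1 - a)
  length-pred = solve-∀
  -[x+0]+x≡0 : ∀ x → - (x + + 0) + x ≡ + 0
  -[x+0]+x≡0 = solve-∀
  -[x+y]+x≡-y : ∀ x y → - (x + y) + x ≡ - y
  -[x+y]+x≡-y = solve-∀
  -[y+x]+x≡-y : ∀ x y → - (y + x) + x ≡ - y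
  -[y+x]+x≡-y = solve-∀

signedProd-snoc : ∀ c a b f → c ≡ b + + 1 - a →
  signedProd (sucℤ c) a (b + + 1) f ≗ signedProd c a b f · f (b + + 1)
signedProd-snoc (+ k)          a b f c≡ r = begin
  prodFrom a (suc k) f r                ≡⟨ prodFrom-snoc a k f r ⟩
  prodFrom a k f r + f (a + + k) r      ≡⟨ cong (λ x → prodFrom a k f r + f x r) a+c≡b+1 ⟩
  prodFrom a k f r + f (b + + 1) r      ∎
  where
    a+c≡b+1 : a + + k ≡ b + + 1
    a+c≡b+1 = trans (cong (λ c → a + c) c≡) (a+[b+1-a]≡b+1 a b)
signedProd-snoc -[1+ zero ]    a b f _ r = sym (-[x+0]+x≡0 (f (b + + 1) r))
signedProd-snoc -[1+ suc k ]   a b f _ r = sym (-[x+y]+x≡-y (f (b + + 1) r) _)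

prodR-snoc : ∀ a b f → prodR a (b + + 1) f ≗ prodR a b f · f (b + + 1)
prodR-snoc a b f r = begin
  prodR a (b + + 1) f r
    ≡⟨ cong (λ g → g r) (prodR≡signedProd a (b + + 1) f) ⟩
  signedProd (b + + 1 + + 1 - a) a (b + + 1) f r
    ≡⟨ cong (λ c → signedProd c a (b + + 1) f r) (length-suc a b) ⟩
  signedProd (sucℤ (b + + 1 - a)) a (b + + 1) f r
    ≡⟨ signedProd-snoc _ a b f refl r ⟩
  signedProd (b + + 1 - a) a b f r + f (b + + 1) r
    ≡⟨ cong (λ g → g r + f (b + + 1) r) (prodR≡signedProd a b f) ⟨
  prodR a b f r + f (b + + 1) r ∎

signedProd-uncons : ∀ c a b f → c ≡ b + + 1 - a →
  signedProd c a b f ≗ f a · signedProd (pred c) (a + + 1) b f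
signedProd-uncons (+ zero)    a b f c≡ r = begin
  + 0                              ≡⟨ -[x+0]+x≡0 (f a r) ⟨
  - (f a r + + 0) + f a r          ≡⟨ +-comm _ (f a r) ⟩
  f a r + - (f a r + + 0)          ≡⟨ cong (λ x → f a r + - (f x r + + 0)) b+1≡a ⟨
  f a r + - (f (b + + 1) r + + 0)  ∎
  where
    b+1≡a : b + + 1 ≡ a
    b+1≡a = trans (sym (+-identityʳ _)) (trans (cong (λ c → b + + 1 - c) c≡) (b+1-[b+1-a]≡a a b))
signedProd-uncons (+ suc k)   a b f _  r = refl
signedProd-uncons -[1+ k ]    a b f c≡ r = begin
  - P                                  ≡⟨ -[y+x]+x≡-y (f a r) P ⟨
  - (P + f a r) + f a r                ≡⟨ +-comm _ (f a r) ⟩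
  f a r + - (P + f a r)                ≡⟨ cong (λ x → f a r + - (P + f x r)) b+1+k+1≡a ⟨
  f a r + - (P + f (b + + 1 + + suc k) r)
    ≡⟨ cong (λ x → f a r + - x) (prodFrom-snoc (b + + 1) (suc k) f r) ⟨
  f a r + - prodFrom (b + + 1) (suc (suc k)) f r ∎
  where
    P : ℤ
    P = prodFrom (b + + 1) (suc k) f r
    b+1+k+1≡a : b + + 1 + + suc k ≡ a
    b+1+k+1≡a = trans (cong (λ c → b + + 1 - c) c≡) (b+1-[b+1-a]≡a a b)

prodR-uncons : ∀ a b f → prodR a b f ≗ f a · prodR (a + + 1) b f
prodR-uncons a b f r = begin
  prodR a b f r
    ≡⟨ cong (λ g → g r) (prodR≡signedProd a b f) ⟩
  signedProd (b + + 1 - a) a b f r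
    ≡⟨ signedProd-uncons _ a b f refl r ⟩
  f a r + signedProd (pred (b + + 1 - a)) (a + + 1) b f r
    ≡⟨ cong (λ c → f a r + signedProd c (a + + 1) b f r) (length-pred a b) ⟨
  f a r + signedProd (b + + 1 - (a + + 1)) (a + + 1) b f r
    ≡⟨ cong (λ g → f a r + g r) (prodR≡signedProd (a + + 1) b f) ⟨
  f a r + prodR (a + + 1) b f r ∎

step-invariant⇒constant : {A : Set} (f : ℤ → A) → (∀ j → f (j + + 1) ≡ f j) → ∀ j → f j ≡ f (+ 0)
step-invariant⇒constant f step (+ zero)       = refl
step-invariant⇒constant f step (+ suc t)      = begin
  f (+ (1 ℕ.+ t))  ≡⟨ cong (λ u → f (+ u)) (ℕ.+-comm 1 t) ⟩
  f (+ t + + 1)    ≡⟨ step (+ t) ⟩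
  f (+ t)          ≡⟨ step-invariant⇒constant f step (+ t) ⟩
  f (+ 0)          ∎
step-invariant⇒constant f step -[1+ zero ]    = sym (step -[1+ 0 ])
step-invariant⇒constant f step -[1+ suc t ]   =
  trans (sym (step -[1+ suc t ])) (step-invariant⇒constant f step -[1+ t ])

frac : Mono → Mono → Mono → Mono → Mono
frac a b c d = a · b ÷ (c · d)

frac-cong : ∀ {a a′ b b′ c c′ d d′} → a ≗ a′ → b ≗ b′ → c ≗ c′ → d ≗ d′ →
  frac a b c d ≗ frac a′ b′ c′ d′
frac-cong a≗ b≗ c≗ d≗ r = cong₂ _+_ (cong₂ _+_ (a≗ r) (b≗ r)) (cong -_ (cong₂ _+_ (c≗ r) (d≗ r)))

frac≗one⇒ab≗cd : ∀ a b c d → frac a b c d ≗ one → a · b ≗ c · d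
frac≗one⇒ab≗cd a b c d q r = i-j≡0⇒i≡j _ _ (q r)

private
  frac-·-regroup : ∀ a a′ b b′ c c′ d d′ →
    (a + a′) + (b + b′) + - ((c + c′) + (d + d′)) ≡ (a + b + - (c + d)) + (a′ + b′ + - (c′ + d′))
  frac-·-regroup = solve-∀
  frac-inv-regroup : ∀ a b c d → - a + - b + - (- c + - d) ≡ - (a + b + - (c + d))
  frac-inv-regroup = solve-∀

frac-· : ∀ a a′ b b′ c c′ d d′ →
  frac (a · a′) (b · b′) (c · c′) (d · d′) ≗ frac a b c d · frac a′ b′ c′ d′
frac-· a a′ b b′ c c′ d d′ r = frac-·-regroup (a r) (a′ r) (b r) (b′ r) (c r) (c′ r) (d r) (d′ r)

frac-inv : ∀ a b c d → frac (inv a) (inv b) (inv c) (inv d) ≗ inv (frac a b c d)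
frac-inv a b c d r = frac-inv-regroup (a r) (b r) (c r) (d r)

-- M n = centredSum (y n), and m0 n i j = staircase (y n) (3i + j) j.
module _ (Y : ℤ → Mono) where

  centredSum : ℤ → ℤ → Mono
  centredSum l k = prodR (- k) k λ i′ → Y (l + + 3 * i′)

  private
    -[K+1]+1≡-K : ∀ K → - (K + + 1) + + 1 ≡ - K
    -[K+1]+1≡-K = solve-∀

  centredSum-step : ∀ l K →
    centredSum l (K + + 1) ≗ Y (l + + 3 * - (K + + 1)) · centredSum l K · Y (l + + 3 * (K + + 1))
  centredSum-step l K r = begin
    prodR (- (K + + 1)) (K + + 1) f r
      ≡⟨ prodR-snoc (- (K + + 1)) K f r ⟩
    prodR (- (K + + 1)) K f r + f (K + + 1) r
      ≡⟨ cong (λ x → x + f (K + + 1) r) (prodR-uncons (- (K + + 1)) K f r) ⟩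
    f (- (K + + 1)) r + prodR (- (K + + 1) + + 1) K f r + f (K + + 1) r
      ≡⟨ cong (λ a → f (- (K + + 1)) r + prodR a K f r + f (K + + 1) r) (-[K+1]+1≡-K K) ⟩
    f (- (K + + 1)) r + prodR (- K) K f r + f (K + + 1) r ∎
    where
      f : ℤ → Mono
      f i′ = Y (l + + 3 * i′)

  centredSum-zero : ∀ l → centredSum l (+ 0) ≗ Y l
  centredSum-zero l r = trans (+-identityʳ _) (cong (λ x → Y x r) (+-identityʳ l))

  centredFrac : ℤ → ℤ → Mono
  centredFrac l K = frac (centredSum (l - + 3) K) (centredSum (l + + 3) K)
                        (centredSum l (K + + 1)) (centredSum l (K - + 1))

  private
    shift-left-outer : ∀ l K → l - + 3 + + 3 * - (K + + 1) ≡ l + + 3 * - (K + + 1 + + 1)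
    shift-left-outer = solve-∀
    shift-right-outer : ∀ l K → l + + 3 + + 3 * (K + + 1) ≡ l + + 3 * (K + + 1 + + 1)
    shift-right-outer = solve-∀
    shift-left-inner : ∀ l K → l - + 3 + + 3 * (K + + 1) ≡ l + + 3 * (K - + 1 + + 1)
    shift-left-inner = solve-∀
    shift-right-inner : ∀ l K → l + + 3 + + 3 * - (K + + 1) ≡ l + + 3 * - (K - + 1 + + 1)
    shift-right-inner = solve-∀
    K+1-1≡K-1+1 : ∀ K → K + + 1 - + 1 ≡ K - + 1 + + 1
    K+1-1≡K-1+1 = solve-∀
    outer-terms-cancel : ∀ a b c d X Z W V →
      (a + X + d) + (c + Z + b) + - ((a + W + b) + (c + V + d)) ≡ X + Z + - (W + V)
    outer-terms-cancel = solve-∀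
    l-3+0≡l+-3 : ∀ l → l - + 3 + + 0 ≡ l + -[1+ 2 ]
    l-3+0≡l+-3 = solve-∀
    centredFrac-zero-value : ∀ a b c → a + + 0 + (c + + 0) + - (a + (b + (c + + 0)) + - (b + + 0)) ≡ + 0
    centredFrac-zero-value = solve-∀

  centredSum-step′ : ∀ l K {a b} → l + + 3 * - (K + + 1) ≡ a → l + + 3 * (K + + 1) ≡ b →
    centredSum l (K + + 1) ≗ Y a · centredSum l K · Y b
  centredSum-step′ l K refl refl = centredSum-step l K

  centredFrac-step : ∀ l K → centredFrac l (K + + 1) ≗ centredFrac l K
  centredFrac-step l K r = begin
    centredFrac l (K + + 1) r
      ≡⟨ cong (λ k → frac (S (l - + 3) (K + + 1)) (S (l + + 3) (K + + 1)) (S l (K + + 1 + + 1)) (S l k) r)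
              (K+1-1≡K-1+1 K) ⟩
    frac (S (l - + 3) (K + + 1)) (S (l + + 3) (K + + 1)) (S l (K + + 1 + + 1)) (S l (K - + 1 + + 1)) r
      ≡⟨ frac-cong (centredSum-step′ (l - + 3) K (shift-left-outer l K) (shift-left-inner l K))
                   (centredSum-step′ (l + + 3) K (shift-right-inner l K) (shift-right-outer l K))
                   (centredSum-step l (K + + 1)) (centredSum-step l (K - + 1)) r ⟩
    frac (Y a · S (l - + 3) K · Y d) (Y c · S (l + + 3) K · Y b)
         (Y a · S l (K + + 1) · Y b) (Y c · S l (K - + 1) · Y d) r
      ≡⟨ outer-terms-cancel (Y a r) (Y b r) (Y c r) (Y d r)
                            (S (l - + 3) K r) (S (l + + 3) K r) (S l (K + + 1) r) (S l (K - + 1) r) ⟩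
    centredFrac l K r ∎
    where
      S : ℤ → ℤ → Mono
      S = centredSum
      a b c d : ℤ
      a = l + + 3 * - (K + + 1 + + 1)
      b = l + + 3 * (K + + 1 + + 1)
      c = l + + 3 * - (K - + 1 + + 1)
      d = l + + 3 * (K - + 1 + + 1)

  centredFrac-zero : ∀ l → centredFrac l (+ 0) ≗ one
  centredFrac-zero l r = begin
    centredFrac l (+ 0) r
      ≡⟨ cong₂ (λ u v → Y u r + + 0 + (Y v r + + 0) + - (centredSum l (+ 1) r + centredSum l -[1+ 0 ] r))
               (l-3+0≡l+-3 l) (+-identityʳ (l + + 3)) ⟩
    Y (l + -[1+ 2 ]) r + + 0 + (Y (l + + 3) r + + 0) + - (centredSum l (+ 1) r + centredSum l -[1+ 0 ] r)
      ≡⟨ centredFrac-zero-value (Y (l + -[1+ 2 ]) r) (Y (l + + 0) r) (Y (l + + 3) r) ⟩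
    + 0 ∎

  centredSum-wave : ∀ l K →
    centredSum (l - + 3) K · centredSum (l + + 3) K ≗ centredSum l (K + + 1) · centredSum l (K - + 1)
  centredSum-wave l K =
    frac≗one⇒ab≗cd (centredSum (l - + 3) K) (centredSum (l + + 3) K)
                   (centredSum l (K + + 1)) (centredSum l (K - + 1)) λ r →
      trans (step-invariant⇒constant (λ k → centredFrac l k r) (λ k → centredFrac-step l k r) K)
            (centredFrac-zero l r)

  staircase : ℤ → ℤ → Mono
  staircase a j = prodR (+ 0) (j - + 1) λ l → prodR (+ 0) l λ m → Y (a - + 4 * l + + 6 * m - + 1)

  progression : ℤ → ℤ → Mono
  progression c b = prodR (+ 0) b λ m → Y (c + + 6 * m)

  private
    j+1-1≡j-1+1 : ∀ j → j + + 1 - + 1 ≡ j - + 1 + + 1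
    j+1-1≡j-1+1 = solve-∀
    j-1+1≡j : ∀ j → j - + 1 + + 1 ≡ j
    j-1+1≡j = solve-∀
    row-offset : ∀ a j m → a - + 4 * j + + 6 * m - + 1 ≡ a - + 4 * j - + 1 + + 6 * m
    row-offset = solve-∀

  staircase-step : ∀ a j → staircase a (j + + 1) ≗ staircase a j · progression (a - + 4 * j - + 1) j
  staircase-step a j r = begin
    prodR (+ 0) (j + + 1 - + 1) F r      ≡⟨ cong (λ b → prodR (+ 0) b F r) (j+1-1≡j-1+1 j) ⟩
    prodR (+ 0) (j - + 1 + + 1) F r      ≡⟨ prodR-snoc (+ 0) (j - + 1) F r ⟩
    staircase a j r + F (j - + 1 + + 1) r ≡⟨ cong (λ l → staircase a j r + F l r) (j-1+1≡j j) ⟩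
    staircase a j r + F j r              ≡⟨ cong (λ x → staircase a j r + x)
                                             (prodR-cong (+ 0) j (λ m → cong-app (cong Y (row-offset a j m))) r) ⟩
    staircase a j r + progression (a - + 4 * j - + 1) j r ∎
    where
      F : ℤ → Mono
      F l = prodR (+ 0) l λ m → Y (a - + 4 * l + + 6 * m - + 1)

  progression-snoc : ∀ c b → progression c (b + + 1) ≗ progression c b · Y (c + + 6 * (b + + 1))
  progression-snoc c b = prodR-snoc (+ 0) b λ m → Y (c + + 6 * m)

  staircase-step′ : ∀ a j {c} → a - + 4 * j - + 1 ≡ c →
    staircase a (j + + 1) ≗ staircase a j · progression c j
  staircase-step′ a j refl = staircase-step a j

  private
    c+6j≡c-6+6[j+1] : ∀ c j → c + + 6 * (j - + 1 + + 1) ≡ c - + 6 + + 6 * (j + + 1)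
    c+6j≡c-6+6[j+1] = solve-∀
    telescope : ∀ A B y → A + (B + y) + - (B + (A + y)) ≡ + 0
    telescope = solve-∀

  progression-frac : ∀ c j →
    frac (progression c (j - + 1)) (progression (c - + 6) (j + + 1))
         (progression (c - + 6) j) (progression c j) ≗ one
  progression-frac c j r = begin
    frac (P c (j - + 1)) (P c′ (j + + 1)) (P c′ j) (P c j) r
      ≡⟨ cong (λ b → frac (P c (j - + 1)) (P c′ (j + + 1)) (P c′ j) (P c b) r) (sym (j-1+1≡j j)) ⟩
    frac (P c (j - + 1)) (P c′ (j + + 1)) (P c′ j) (P c (j - + 1 + + 1)) r
      ≡⟨ cong₂ (λ u v → P c (j - + 1) r + u + - (P c′ j r + v))
               (progression-snoc c′ j r) (progression-snoc c (j - + 1) r) ⟩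
    frac (P c (j - + 1)) (P c′ j · Y z) (P c′ j) (P c (j - + 1) · Y (c + + 6 * (j - + 1 + + 1))) r
      ≡⟨ cong (λ x → frac (P c (j - + 1)) (P c′ j · Y z) (P c′ j) (P c (j - + 1) · Y x) r)
              (c+6j≡c-6+6[j+1] c j) ⟩
    frac (P c (j - + 1)) (P c′ j · Y z) (P c′ j) (P c (j - + 1) · Y z) r
      ≡⟨ telescope (P c (j - + 1) r) (P c′ j r) (Y z r) ⟩
    + 0 ∎
    where
      P : ℤ → ℤ → Mono
      P = progression
      c′ z : ℤ
      c′ = c - + 6
      z = c′ + + 6 * (j + + 1)

  staircaseFrac : ℤ → ℤ → Mono
  staircaseFrac a j = frac (staircase (a - + 1) (j - + 1)) (staircase (a + + 1) (j + + 1))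
                           (staircase (a - + 3) j) (staircase (a + + 3) j)

  private
    row-[a-1,j-1] : ∀ a j → a - + 1 - + 4 * (j - + 1) - + 1 ≡ a - + 4 * j + + 2
    row-[a-1,j-1] = solve-∀
    row-[a+1,j+1] : ∀ a j → a + + 1 - + 4 * (j + + 1) - + 1 ≡ a - + 4 * j + + 2 - + 6
    row-[a+1,j+1] = solve-∀
    row-[a-3,j] : ∀ a j → a - + 3 - + 4 * j - + 1 ≡ a - + 4 * j + + 2 - + 6
    row-[a-3,j] = solve-∀
    row-[a+3,j] : ∀ a j → a + + 3 - + 4 * j - + 1 ≡ a - + 4 * j + + 2
    row-[a+3,j] = solve-∀
    a+1+0+0-1≡a : ∀ a → a + + 1 + + 0 + + 0 + -[1+ 0 ] ≡ a
    a+1+0+0-1≡a = solve-∀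
    staircaseFrac-zero-value : ∀ x → + 0 + ((x + + 0) + + 0) + - (+ 0 + + 0) ≡ x
    staircaseFrac-zero-value = solve-∀

  staircaseFrac-step : ∀ a j → staircaseFrac a (j + + 1) ≗ staircaseFrac a j
  staircaseFrac-step a j r = begin
    staircaseFrac a (j + + 1) r
      ≡⟨ cong (λ b → frac (S (a - + 1) b) (S (a + + 1) (j + + 1 + + 1))
                          (S (a - + 3) (j + + 1)) (S (a + + 3) (j + + 1)) r)
              (j+1-1≡j-1+1 j) ⟩
    frac (S (a - + 1) (j - + 1 + + 1)) (S (a + + 1) (j + + 1 + + 1))
         (S (a - + 3) (j + + 1)) (S (a + + 3) (j + + 1)) r
      ≡⟨ frac-cong (staircase-step′ (a - + 1) (j - + 1) (row-[a-1,j-1] a j))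
                   (staircase-step′ (a + + 1) (j + + 1) (row-[a+1,j+1] a j))
                   (staircase-step′ (a - + 3) j (row-[a-3,j] a j))
                   (staircase-step′ (a + + 3) j (row-[a+3,j] a j)) r ⟩
    frac (S (a - + 1) (j - + 1) · P c (j - + 1)) (S (a + + 1) (j + + 1) · P (c - + 6) (j + + 1))
         (S (a - + 3) j · P (c - + 6) j) (S (a + + 3) j · P c j) r
      ≡⟨ frac-· (S (a - + 1) (j - + 1)) (P c (j - + 1)) (S (a + + 1) (j + + 1)) (P (c - + 6) (j + + 1))
                (S (a - + 3) j) (P (c - + 6) j) (S (a + + 3) j) (P c j) r ⟩
    staircaseFrac a j r + frac (P c (j - + 1)) (P (c - + 6) (j + + 1)) (P (c - + 6) j) (P c j) r
      ≡⟨ cong (λ x → staircaseFrac a j r + x) (progression-frac c j r) ⟩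
    staircaseFrac a j r + + 0
      ≡⟨ +-identityʳ _ ⟩
    staircaseFrac a j r ∎
    where
      S P : ℤ → ℤ → Mono
      S = staircase
      P = progression
      -- the rows added at (a - 1, j - 1) and (a + 3, j) both start at c, those added at
      -- (a + 1, j + 1) and (a - 3, j) both start at c - 6
      c : ℤ
      c = a - + 4 * j + + 2

  staircaseFrac-zero : ∀ a → staircaseFrac a (+ 0) ≗ Y a
  staircaseFrac-zero a r =
    trans (staircaseFrac-zero-value (Y (a + + 1 + + 0 + + 0 + -[1+ 0 ]) r))
          (cong (λ x → Y x r) (a+1+0+0-1≡a a))

  staircaseFrac≗Y : ∀ a j → staircaseFrac a j ≗ Y a
  staircaseFrac≗Y a j r =
    trans (step-invariant⇒constant (λ k → staircaseFrac a k r) (λ k → staircaseFrac-step a k r) j)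
          (staircaseFrac-zero a r)

ratio : (ℤ → ℤ → Mono) → ℤ → ℤ → Mono
ratio F i j = frac (F i (j - + 1)) (F i (j + + 1)) (F (i - + 1) j) (F (i + + 1) j)

private
  3i+[j-1]≡3i+j-1 : ∀ i j → + 3 * i + (j - + 1) ≡ + 3 * i + j - + 1
  3i+[j-1]≡3i+j-1 = solve-∀
  3i+[j+1]≡3i+j+1 : ∀ i j → + 3 * i + (j + + 1) ≡ + 3 * i + j + + 1
  3i+[j+1]≡3i+j+1 = solve-∀
  3[i-1]+j≡3i+j-3 : ∀ i j → + 3 * (i - + 1) + j ≡ + 3 * i + j - + 3
  3[i-1]+j≡3i+j-3 = solve-∀
  3[i+1]+j≡3i+j+3 : ∀ i j → + 3 * (i + + 1) + j ≡ + 3 * i + j + + 3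
  3[i+1]+j≡3i+j+3 = solve-∀

ratio-diagonal : ∀ (H : ℤ → ℤ → Mono) i j → let l = + 3 * i + j in
  ratio (λ i′ j′ → H (+ 3 * i′ + j′) j′) i j ≗
  frac (H (l - + 1) (j - + 1)) (H (l + + 1) (j + + 1)) (H (l - + 3) j) (H (l + + 3) j)
ratio-diagonal H i j r =
  cong₂ _+_ (cong₂ _+_ (H≡ (3i+[j-1]≡3i+j-1 i j)) (H≡ (3i+[j+1]≡3i+j+1 i j)))
            (cong -_ (cong₂ _+_ (H≡ (3[i-1]+j≡3i+j-3 i j)) (H≡ (3[i+1]+j≡3i+j+3 i j))))
  where
    H≡ : ∀ {a b j′} → a ≡ b → H a j′ r ≡ H b j′ r
    H≡ {j′ = j′} = cong (λ a → H a j′ r)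

module _ (n : ℕ) where

  mLayer : ℕ → ℤ → ℤ → Mono
  mLayer t i j = mAux n i j t

  private
    recurrence-regroup : ∀ A B C D E F G H I J K L →
      (A + B + - C) + (D + E + - F) + - ((G + H + - I) + (J + K + - L))
        ≡ (A + D + - (G + H)) + (B + E + - (J + K)) + - (C + F + - (I + L))
    recurrence-regroup = solve-∀
    x+y-y≡x : ∀ x y → x + y + - y ≡ x
    x+y-y≡x = solve-∀

  ratio-mLayer-recurrence : ∀ t i j →
    ratio (mLayer (suc (suc t))) i j ≗
    ratio (mLayer (suc t)) (i - + 1) j · ratio (mLayer (suc t)) (i + + 1) j ÷ ratio (mLayer t) i j
  ratio-mLayer-recurrence t i j r = recurrence-regroup
    (μ′ (i - + 1) (j - + 1)) (μ′ (i + + 1) (j - + 1)) (μ i (j - + 1))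
    (μ′ (i - + 1) (j + + 1)) (μ′ (i + + 1) (j + + 1)) (μ i (j + + 1))
    (μ′ (i - + 1 - + 1) j) (μ′ (i - + 1 + + 1) j) (μ (i - + 1) j)
    (μ′ (i + + 1 - + 1) j) (μ′ (i + + 1 + + 1) j) (μ (i + + 1) j)
    where
      μ μ′ : ℤ → ℤ → ℤ
      μ i j = mLayer t i j r
      μ′ i j = mLayer (suc t) i j r

  ratio-m0 : ∀ i j → ratio (m0 n) i j ≗ y n (+ 3 * i + j)
  ratio-m0 i j r =
    trans (ratio-diagonal (staircase (y n)) i j r) (staircaseFrac≗Y (y n) (+ 3 * i + j) j r)

  ratio-mLayer : ∀ t i j → ratio (mLayer t) i j ≗ M n (+ 3 * i + j) (+ t - + 1)
  ratio-mLayer zero          i j r = begin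
    ratio (mLayer 0) i j r  ≡⟨ frac-inv (m0 n i (j - + 1)) (m0 n i (j + + 1))
                                        (m0 n (i - + 1) j) (m0 n (i + + 1) j) r ⟩
    - ratio (m0 n) i j r    ≡⟨ cong -_ (ratio-m0 i j r) ⟩
    - y n l r               ≡⟨ cong -_ (centredSum-zero (y n) l r) ⟨
    M n l -[1+ 0 ] r        ∎
    where
      l : ℤ
      l = + 3 * i + j
  ratio-mLayer (suc zero)    i j r =
    trans (ratio-m0 i j r) (sym (centredSum-zero (y n) (+ 3 * i + j) r))
  ratio-mLayer (suc (suc t)) i j r = begin
    ratio (mLayer (suc (suc t))) i j r
      ≡⟨ ratio-mLayer-recurrence t i j r ⟩
    ratio (mLayer (suc t)) (i - + 1) j r + ratio (mLayer (suc t)) (i + + 1) j r + - ratio (mLayer t) i j r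
      ≡⟨ cong₂ _+_ (cong₂ _+_ (ratio-mLayer (suc t) (i - + 1) j r) (ratio-mLayer (suc t) (i + + 1) j r))
                   (cong -_ (ratio-mLayer t i j r)) ⟩
    M n (+ 3 * (i - + 1) + j) (+ t) r + M n (+ 3 * (i + + 1) + j) (+ t) r + - M n l (+ t - + 1) r
      ≡⟨ cong₂ (λ a b → M n a (+ t) r + M n b (+ t) r + - M n l (+ t - + 1) r)
               (3[i-1]+j≡3i+j-3 i j) (3[i+1]+j≡3i+j+3 i j) ⟩
    M n (l - + 3) (+ t) r + M n (l + + 3) (+ t) r + - M n l (+ t - + 1) r
      ≡⟨ cong (λ x → x + - M n l (+ t - + 1) r) (centredSum-wave (y n) l (+ t) r) ⟩
    M n l (+ t + + 1) r + M n l (+ t - + 1) r + - M n l (+ t - + 1) r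
      ≡⟨ x+y-y≡x (M n l (+ t + + 1) r) (M n l (+ t - + 1) r) ⟩
    M n l (+ (t ℕ.+ 1)) r
      ≡⟨ cong (λ u → M n l (+ u) r) (ℕ.+-comm t 1) ⟩
    M n l (+ suc t) r ∎
    where
      l : ℤ
      l = + 3 * i + j

+∣k+1∣-1≡k : ∀ k → -[1+ 0 ] ≤ k → + ∣ k + + 1 ∣ - + 1 ≡ k
+∣k+1∣-1≡k (+ k)          _       = cong (λ u → + u - + 1) (ℕ.+-comm k 1)
+∣k+1∣-1≡k -[1+ zero ]    _       = refl
+∣k+1∣-1≡k -[1+ suc k ]   (-≤- ())

lemma6p2 : (n : ℕ) → n ≥ 1 → (i j k : ℤ) → -[1+ 0 ] ≤ k →
    ∀ r → (m n i (j - + 1) k · m n i (j + + 1) k ÷ (m n (i - + 1) j k · m n (i + + 1) j k)) r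
          ≡ M n (+ 3 * i + j) k r
lemma6p2 n _ i j k -1≤k r = begin
  ratio (mLayer n ∣ k + + 1 ∣) i j r             ≡⟨ ratio-mLayer n ∣ k + + 1 ∣ i j r ⟩
  M n (+ 3 * i + j) (+ ∣ k + + 1 ∣ - + 1) r     ≡⟨ cong (λ k′ → M n (+ 3 * i + j) k′ r) (+∣k+1∣-1≡k k -1≤k) ⟩
  M n (+ 3 * i + j) k r                          ∎
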